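{- The $\pi$-calculus with pattern matching is not strongly replacement free: there exist a context $C$, an invisible process $I$ and a process $P$ of this calculus such that $C[I]\Downarrow$ but not $C[P]\Downarrow$.
   Context: The $\pi$-calculus with pattern matching is the $\pi$-calculus in which the object of an input is a pattern, i.e. a tuple of names some of which are marked $\lceil x\rceil$ (marked names stand for themselves and are unaffected by substitutions, $\lceil x\rceil\sigma=\lceil x\rceil$), the others being placeholders, and the object of an output is a tuple of names. A pattern $\tilde x$ matches a tuple $\tilde b$ of the same length if there is a substitution $\sigma$ with $\tilde x\sigma=\tilde b$ (after removing the marks), the least such being returned; $a(\tilde x).P$ and $\overline a\langle\tilde b\rangle.Q$ synchronize iff $\tilde x$ and $\tilde b$ match with substitution $\sigma$, and then the input becomes $P\sigma$. Other rules are as in the $\pi$-calculus; input and output actions are visible, $\tau$ is invisible. A context is a term with one hole; $C[P]$ is hole filling. $\Rightarrow$ is the reflexive-transitive closure of $\xrightarrow{\tau}$; $P\Downarrow$ iff $P\Rightarrow\xrightarrow{\alpha}\Rightarrow P'$ for some visible $\alpha$ and $P'$; $P$ is invisible iff not $P\Downarrow$. -}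

module Defs where

open import Data.Nat using (ℕ; _≡ᵇ_)
open import Data.Bool using (Bool; true; false; if_then_else_)
open import Data.List using (List; []; _∷_; map)
open import Data.List.Membership.Propositional using (_∈_)
open import Data.Product using (Σ; _×_; _,_)
open import Relation.Binary.PropositionalEquality using (_≡_; _≢_)
open import Relation.Nullary using (¬_)
open import Data.Sum using (_⊎_)

Name : Set
Name = ℕ

-- An element of an input pattern: a marked name ⌈n⌉ or a placeholder x.
data PEl : Set where
  mark : Name → PEl
  var  : Name → PEl

Pattern : Set
Pattern = List PEl

phs : Pattern → List Name
phs []            = []
phs (mark _ ∷ ps) = phs ps
phs (var x ∷ ps)  = x ∷ phs ps

elemᵇ : Name → List Name → Bool
elemᵇ _ []       = false
elemᵇ n (m ∷ ms) = if n ≡ᵇ m then true else elemᵇ n ms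

infixr 6 _∥_
infix 4 _—[_]→_
data Proc : Set where
  𝟘   : Proc
  inp : Name → Pattern → Proc → Proc        -- a(x̃).P   (placeholders of x̃ bind in P)
  out : Name → List Name → Proc → Proc
  _∥_ : Proc → Proc → Proc
  ν   : Name → Proc → Proc
  !_  : Proc → Proc

-- Free names.  Marked names stand for themselves: they are never bound
-- and never substituted.  Plain (unmarked) occurrences are bound by
-- restriction and by placeholders of an enclosing input.

data PlainFree (n : Name) : Proc → Set where
  pf-outc : ∀ {bs P} → PlainFree n (out n bs P)
  pf-outa : ∀ {a bs P} → n ∈ bs → PlainFree n (out a bs P)
  pf-outk : ∀ {a bs P} → PlainFree n P → PlainFree n (out a bs P)
  pf-inc  : ∀ {ps P} → PlainFree n (inp n ps P)
  pf-ink  : ∀ {a ps P} → PlainFree n P → ¬ (n ∈ phs ps) → PlainFree n (inp a ps P)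
  pf-parl : ∀ {P Q} → PlainFree n P → PlainFree n (P ∥ Q)
  pf-parr : ∀ {P Q} → PlainFree n Q → PlainFree n (P ∥ Q)
  pf-res  : ∀ {m P} → PlainFree n P → n ≢ m → PlainFree n (ν m P)
  pf-rep  : ∀ {P} → PlainFree n P → PlainFree n (! P)

data MarkIn (n : Name) : Proc → Set where
  mi-pat  : ∀ {a ps P} → mark n ∈ ps → MarkIn n (inp a ps P)
  mi-ink  : ∀ {a ps P} → MarkIn n P → MarkIn n (inp a ps P)
  mi-outk : ∀ {a bs P} → MarkIn n P → MarkIn n (out a bs P)
  mi-parl : ∀ {P Q} → MarkIn n P → MarkIn n (P ∥ Q)
  mi-parr : ∀ {P Q} → MarkIn n Q → MarkIn n (P ∥ Q)
  mi-res  : ∀ {m P} → MarkIn n P → MarkIn n (ν m P)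
  mi-rep  : ∀ {P} → MarkIn n P → MarkIn n (! P)

FreeIn : Name → Proc → Set
FreeIn n P = PlainFree n P ⊎ MarkIn n P

-- Substitutions σ : Name → Name, applied capture-avoidingly.
-- Marked names are unaffected: ⌈x⌉σ = ⌈x⌉.
-- Sub σ P P' : P' is (an α-variant of) Pσ; bound names may be renamed
-- to fresh ones.

update : (Name → Name) → Name → Name → (Name → Name)
update σ n m y = if y ≡ᵇ n then m else σ y

renPEl : (Name → Name) → PEl → PEl
renPEl ρ (mark n) = mark n
renPEl ρ (var x)  = var (ρ x)

data Sub (σ : Name → Name) : Proc → Proc → Set where
  s-nil : Sub σ 𝟘 𝟘
  s-out : ∀ {a bs P P'} → Sub σ P P' → Sub σ (out a bs P) (out (σ a) (map σ bs) P')
  s-par : ∀ {P Q P' Q'} → Sub σ P P' → Sub σ Q Q' → Sub σ (P ∥ Q) (P' ∥ Q')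
  s-rep : ∀ {P P'} → Sub σ P P' → Sub σ (! P) (! P')
  s-res : ∀ {n m P P'} →
          (∀ y → PlainFree y (ν n P) → σ y ≢ m) →
          Sub (update σ n m) P P' →
          Sub σ (ν n P) (ν m P')
  s-inp : ∀ {a ps P P'} (ρ : Name → Name) →
          (∀ x y → x ∈ phs ps → y ∈ phs ps → ρ x ≡ ρ y → x ≡ y) →
          (∀ x y → x ∈ phs ps → PlainFree y (inp a ps P) → σ y ≢ ρ x) →
          Sub (λ y → if elemᵇ y (phs ps) then ρ y else σ y) P P' →
          Sub σ (inp a ps P) (inp (σ a) (map (renPEl ρ) ps) P')

-- Pattern matching: x̃ matches b̃ with the least σ such that x̃σ = b̃
-- (marks removed); σ is the identity outside the placeholders of x̃.

data MatchPW (σ : Name → Name) : Pattern → List Name → Set where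
  m-nil  : MatchPW σ [] []
  m-mark : ∀ {n b ps bs} → n ≡ b → MatchPW σ ps bs → MatchPW σ (mark n ∷ ps) (b ∷ bs)
  m-var  : ∀ {x b ps bs} → σ x ≡ b → MatchPW σ ps bs → MatchPW σ (var x ∷ ps) (b ∷ bs)

Match : Pattern → List Name → (Name → Name) → Set
Match ps bs σ = MatchPW σ ps bs × (∀ y → ¬ (y ∈ phs ps) → σ y ≡ y)

-- Actions (early input; output with a list of extruded bound names)

data Act : Set where
  τ    : Act
  inA  : Name → List Name → Act
  outA : Name → List Name → List Name → Act   -- ā(νñ)⟨b̃⟩ : channel, b̃, ñ

bn : Act → List Name
bn τ            = []
bn (inA _ _)    = []
bn (outA _ _ ns) = ns

data NameIn (n : Name) : Act → Set where
  ni-inc  : ∀ {bs} → NameIn n (inA n bs)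
  ni-ina  : ∀ {a bs} → n ∈ bs → NameIn n (inA a bs)
  ni-outc : ∀ {bs ns} → NameIn n (outA n bs ns)
  ni-outa : ∀ {a bs ns} → n ∈ bs → NameIn n (outA a bs ns)
  ni-outb : ∀ {a bs ns} → n ∈ ns → NameIn n (outA a bs ns)

data Visible : Act → Set where
  vis-in  : ∀ {a bs} → Visible (inA a bs)
  vis-out : ∀ {a bs ns} → Visible (outA a bs ns)

resAll : List Name → Proc → Proc
resAll []       P = P
resAll (n ∷ ns) P = ν n (resAll ns P)

data _—[_]→_ : Proc → Act → Proc → Set where
  t-out  : ∀ {a bs P} → out a bs P —[ outA a bs [] ]→ P
  t-inp  : ∀ {a ps bs P P'} σ → Match ps bs σ → Sub σ P P' →
           inp a ps P —[ inA a bs ]→ P'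
  t-parl : ∀ {P Q P' α} → P —[ α ]→ P' → (∀ n → n ∈ bn α → ¬ FreeIn n Q) →
           (P ∥ Q) —[ α ]→ (P' ∥ Q)
  t-parr : ∀ {P Q Q' α} → Q —[ α ]→ Q' → (∀ n → n ∈ bn α → ¬ FreeIn n P) →
           (P ∥ Q) —[ α ]→ (P ∥ Q')
  t-coml : ∀ {P Q P' Q' a bs ns} → P —[ outA a bs ns ]→ P' → Q —[ inA a bs ]→ Q' →
           (∀ n → n ∈ ns → ¬ FreeIn n Q) →
           (P ∥ Q) —[ τ ]→ resAll ns (P' ∥ Q')
  t-comr : ∀ {P Q P' Q' a bs ns} → P —[ inA a bs ]→ P' → Q —[ outA a bs ns ]→ Q' →
           (∀ n → n ∈ ns → ¬ FreeIn n P) →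
           (P ∥ Q) —[ τ ]→ resAll ns (P' ∥ Q')
  -- restriction, with α-conversion of the bound name n to a fresh m
  t-res  : ∀ {n m P P₀ P' α} → ¬ PlainFree m (ν n P) → Sub (update (λ y → y) n m) P P₀ →
           P₀ —[ α ]→ P' → ¬ NameIn m α →
           ν n P —[ α ]→ ν m P'
  -- scope extrusion (open), with α-conversion of n to a fresh m
  t-open : ∀ {n m P P₀ P' a bs ns} → ¬ PlainFree m (ν n P) → Sub (update (λ y → y) n m) P P₀ →
           P₀ —[ outA a bs ns ]→ P' → m ∈ bs → m ≢ a → ¬ (m ∈ ns) →
           ν n P —[ outA a bs (m ∷ ns) ]→ P'
  t-rep  : ∀ {P P' α} → ((! P) ∥ P) —[ α ]→ P' → (! P) —[ α ]→ P'

data _⇒_ : Proc → Proc → Set where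
  ⇒-refl : ∀ {P} → P ⇒ P
  ⇒-step : ∀ {P Q R} → P —[ τ ]→ Q → Q ⇒ R → P ⇒ R

_⇓ : Proc → Set
P ⇓ = Σ Proc λ P₁ → Σ Act λ α → Σ Proc λ P₂ → Σ Proc λ P' →
      Visible α × P ⇒ P₁ × P₁ —[ α ]→ P₂ × P₂ ⇒ P'

Invisible : Proc → Set
Invisible P = ¬ (P ⇓)

-- Contexts with one hole, and hole filling (may capture names)

data Ctx : Set where
  hole : Ctx
  inpC : Name → Pattern → Ctx → Ctx
  outC : Name → List Name → Ctx → Ctx
  parlC : Ctx → Proc → Ctx
  parrC : Proc → Ctx → Ctx
  νC   : Name → Ctx → Ctx
  !C   : Ctx → Ctx

_[_] : Ctx → Proc → Proc
hole [ P ]        = P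
inpC a ps C [ P ] = inp a ps (C [ P ])
outC a bs C [ P ] = out a bs (C [ P ])
parlC C Q [ P ]   = (C [ P ]) ∥ Q
parrC Q C [ P ]   = Q ∥ (C [ P ])
νC n C [ P ]      = ν n (C [ P ])
!C C [ P ]        = ! (C [ P ])

-- The process (ν3)(3̄⟨2⟩ ∥ 3(⌈1⌉).4̄) is deadlocked only because the marked
-- name ⌈1⌉ does not match 2.  Marks are immune to substitution, but the sent
-- name 2 is not: the context (ν0)(0̄⟨1⟩ ∥ 0(2).[ ]) binds 2 as a placeholder
-- and instantiates it with 1, after which the internal communication succeeds
-- and the barb on 4 appears.  With 𝟘 in the hole the context merely performs
-- one internal communication and stops.
module Submission where

open import Defs
open import Data.Product using (Σ; _×_; _,_; proj₂)
open import Data.Nat using (suc)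
open import Data.List using ([]; _∷_)
open import Data.List.Membership.Propositional using (_∈_)
open import Data.List.Relation.Unary.Any using (here; there)
open import Data.Sum using (_⊎_; inj₁; inj₂)
open import Data.Empty using (⊥-elim)
open import Relation.Nullary using (¬_)
open import Relation.Binary.PropositionalEquality using (_≡_; refl; _≢_)

Stuck : Proc → Set
Stuck P = ∀ {α Q} → ¬ (P —[ α ]→ Q)

stuck-𝟘 : Stuck 𝟘
stuck-𝟘 ()

stuck-∥ : ∀ {P Q} → Stuck P → Stuck Q → Stuck (P ∥ Q)
stuck-∥ sP sQ (t-parl tr _)   = sP tr
stuck-∥ sP sQ (t-parr tr _)   = sQ tr
stuck-∥ sP sQ (t-coml tr _ _) = sP tr
stuck-∥ sP sQ (t-comr tr _ _) = sP tr

invisible-if-τ-closed : ∀ {P} → (∀ {α Q} → P —[ α ]→ Q → α ≡ τ × Invisible Q) → Invisible P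
invisible-if-τ-closed closed (_ , _ , _ , _ , vis , ⇒-refl , tr , _) with closed tr
invisible-if-τ-closed closed (_ , _ , _ , _ , () , ⇒-refl , tr , _) | refl , _
invisible-if-τ-closed closed (_ , _ , _ , _ , vis , ⇒-step s rest , tr , post) =
  proj₂ (closed s) (_ , _ , _ , _ , vis , rest , tr , post)

stuck⇒invisible : ∀ {P} → Stuck P → Invisible P
stuck⇒invisible stuck = invisible-if-τ-closed (λ tr → ⊥-elim (stuck tr))

visible-step⇒⇓ : ∀ {P α Q} → Visible α → P —[ α ]→ Q → P ⇓
visible-step⇒⇓ vis tr = _ , _ , _ , _ , vis , ⇒-refl , tr , ⇒-refl

⇓-τ-backward : ∀ {P Q} → P —[ τ ]→ Q → Q ⇓ → P ⇓
⇓-τ-backward s (_ , _ , _ , _ , vis , pre , tr , post) = _ , _ , _ , _ , vis , ⇒-step s pre , tr , post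

¬free-𝟘 : ∀ {n} → ¬ FreeIn n 𝟘
¬free-𝟘 (inj₁ ())
¬free-𝟘 (inj₂ ())

idName : Name → Name
idName y = y

¬plainFree-ν : ∀ {n P} → ¬ PlainFree n (ν n P)
¬plainFree-ν (pf-res _ n≢n) = n≢n refl

barb : Proc
barb = out 4 [] 𝟘

-- (ν3)(3̄⟨b⟩ ∥ 3(⌈1⌉).4̄): the barb on 4 is released exactly when b is 1.
guarded : Name → Proc
guarded b = ν 3 (out 3 (b ∷ []) 𝟘 ∥ inp 3 (mark 1 ∷ []) barb)

released : Proc
released = ν 3 (𝟘 ∥ barb)

plainFree-guarded : ∀ {b y} → PlainFree y (guarded b) → y ≡ b ⊎ y ≡ 4
plainFree-guarded (pf-res (pf-parl pf-outc) 3≢3)                = ⊥-elim (3≢3 refl)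
plainFree-guarded (pf-res (pf-parl (pf-outa (here refl))) _)     = inj₁ refl
plainFree-guarded (pf-res (pf-parl (pf-outa (there ()))) _)
plainFree-guarded (pf-res (pf-parl (pf-outk ())) _)
plainFree-guarded (pf-res (pf-parr pf-inc) 3≢3)                 = ⊥-elim (3≢3 refl)
plainFree-guarded (pf-res (pf-parr (pf-ink pf-outc _)) _)       = inj₂ refl
plainFree-guarded (pf-res (pf-parr (pf-ink (pf-outa ()) _)) _)
plainFree-guarded (pf-res (pf-parr (pf-ink (pf-outk ()) _)) _)

plainFree-released : ∀ {y} → PlainFree y released → y ≡ 4
plainFree-released (pf-res (pf-parl ()) _)
plainFree-released (pf-res (pf-parr pf-outc) _) = refl
plainFree-released (pf-res (pf-parr (pf-outa ())) _)
plainFree-released (pf-res (pf-parr (pf-outk ())) _)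

sub-guard : ∀ σ → Sub σ (inp 3 (mark 1 ∷ []) barb) (inp (σ 3) (mark 1 ∷ []) (out (σ 4) [] 𝟘))
sub-guard σ = s-inp idName (λ { _ _ () }) (λ _ _ ()) (s-out s-nil)

sub-guarded : ∀ σ b → σ b ≢ 3 → σ 4 ≢ 3 →
              Sub σ (guarded b)
                    (ν 3 (out 3 (update σ 3 3 b ∷ []) 𝟘 ∥ inp 3 (mark 1 ∷ []) (out (σ 4) [] 𝟘)))
sub-guarded σ b σb≢3 σ4≢3 = s-res avoids (s-par (s-out s-nil) (sub-guard (update σ 3 3)))
  where
  avoids : ∀ y → PlainFree y (guarded b) → σ y ≢ 3
  avoids y pf with plainFree-guarded pf
  ... | inj₁ refl = σb≢3
  ... | inj₂ refl = σ4≢3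

sub-released : ∀ σ → σ 4 ≢ 3 → Sub σ released (ν 3 (𝟘 ∥ out (σ 4) [] 𝟘))
sub-released σ σ4≢3 = s-res avoids (s-par s-nil (s-out s-nil))
  where
  avoids : ∀ y → PlainFree y released → σ y ≢ 3
  avoids y pf with plainFree-released pf
  ... | refl = σ4≢3

-- After α-converting the restricted 3 to m, the guard still reads ⌈1⌉ while 2
-- is left untouched, so the private communication cannot match.
stuck-guarded-2 : Stuck (guarded 2)
stuck-guarded-2 (t-res _ (s-par (s-out s-nil) (s-inp _ _ _ (s-out s-nil))) (t-parl t-out _) m∉α) = m∉α ni-outc
stuck-guarded-2 (t-res _ (s-par (s-out s-nil) (s-inp _ _ _ (s-out s-nil))) (t-parr (t-inp _ _ _) _) m∉α) = m∉α ni-inc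
stuck-guarded-2 (t-res _ (s-par (s-out s-nil) (s-inp _ _ _ (s-out s-nil))) (t-coml t-out (t-inp _ (m-mark () _ , _) _) _) _)
stuck-guarded-2 (t-res _ (s-par (s-out s-nil) (s-inp _ _ _ (s-out s-nil))) (t-comr () _ _) _)
stuck-guarded-2 (t-open _ (s-par (s-out s-nil) (s-inp _ _ _ (s-out s-nil))) (t-parl t-out _) _ m≢m _) = m≢m refl
stuck-guarded-2 (t-open _ (s-par (s-out s-nil) (s-inp _ _ _ (s-out s-nil))) (t-parr () _) _ _ _)

guarded-1-unblocks : guarded 1 —[ τ ]→ released
guarded-1-unblocks =
  t-res ¬plainFree-ν (s-par (s-out s-nil) (sub-guard (update idName 3 3)))
        (t-coml t-out (t-inp idName (m-mark refl m-nil , λ _ _ → refl) (s-out s-nil)) (λ _ ()))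
        (λ ())

released-barb : released —[ outA 4 [] [] ]→ ν 3 (𝟘 ∥ 𝟘)
released-barb =
  t-res ¬plainFree-ν (s-par s-nil (s-out s-nil)) (t-parr t-out (λ _ ()))
        (λ { (ni-outa ()) ; (ni-outb ()) })

instantiate-2-by-1 : Ctx
instantiate-2-by-1 = νC 0 (parrC (out 0 (1 ∷ []) 𝟘) (inpC 0 (var 2 ∷ []) hole))

after-handshake-𝟘-stuck : ∀ m → Stuck (ν m (𝟘 ∥ 𝟘))
after-handshake-𝟘-stuck m (t-res _ (s-par s-nil s-nil) tr _)       = stuck-∥ stuck-𝟘 stuck-𝟘 tr
after-handshake-𝟘-stuck m (t-open _ (s-par s-nil s-nil) tr _ _ _) = stuck-∥ stuck-𝟘 stuck-𝟘 tr

invisible-instantiate-𝟘 : Invisible (instantiate-2-by-1 [ 𝟘 ])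
invisible-instantiate-𝟘 = invisible-if-τ-closed only-handshake
  where
  only-handshake : ∀ {α Q} → instantiate-2-by-1 [ 𝟘 ] —[ α ]→ Q → α ≡ τ × Invisible Q
  only-handshake (t-res _ (s-par (s-out s-nil) (s-inp _ _ _ s-nil)) (t-parl t-out _) m∉α) = ⊥-elim (m∉α ni-outc)
  only-handshake (t-res _ (s-par (s-out s-nil) (s-inp _ _ _ s-nil)) (t-parr (t-inp _ _ _) _) m∉α) = ⊥-elim (m∉α ni-inc)
  only-handshake (t-res _ (s-par (s-out s-nil) (s-inp _ _ _ s-nil)) (t-coml t-out (t-inp _ _ s-nil) _) _) =
    refl , stuck⇒invisible (after-handshake-𝟘-stuck _)
  only-handshake (t-res _ (s-par (s-out s-nil) (s-inp _ _ _ s-nil)) (t-comr () _ _) _)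
  only-handshake (t-open _ (s-par (s-out s-nil) (s-inp _ _ _ s-nil)) (t-parl t-out _) _ m≢m _) = ⊥-elim (m≢m refl)
  only-handshake (t-open _ (s-par (s-out s-nil) (s-inp _ _ _ s-nil)) (t-parr () _) _ _ _)

instantiate-guarded-2-⇓ : (instantiate-2-by-1 [ guarded 2 ]) ⇓
instantiate-guarded-2-⇓ =
  ⇓-τ-backward handshake (⇓-τ-backward unblock (visible-step⇒⇓ vis-out barb-on-4))
  where
  -- The trivial α-conversion of the restricted 0; it is not definitionally the identity.
  σ₀ : Name → Name
  σ₀ = update idName 0 0

  σ₂↦₁ : Name → Name
  σ₂↦₁ = update idName 2 1

  inside : ∀ {P P' α} → P —[ α ]→ P' → Sub σ₀ P P → ¬ NameIn 0 α → ν 0 (𝟘 ∥ P) —[ α ]→ ν 0 (𝟘 ∥ P')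
  inside tr sub 0∉α = t-res ¬plainFree-ν (s-par s-nil sub) (t-parr tr (λ _ _ → ¬free-𝟘)) 0∉α

  unblock : ν 0 (𝟘 ∥ guarded 1) —[ τ ]→ ν 0 (𝟘 ∥ released)
  unblock = inside guarded-1-unblocks (sub-guarded σ₀ 1 (λ ()) (λ ())) (λ ())

  barb-on-4 : ν 0 (𝟘 ∥ released) —[ outA 4 [] [] ]→ ν 0 (𝟘 ∥ ν 3 (𝟘 ∥ 𝟘))
  barb-on-4 = inside released-barb (sub-released σ₀ (λ ())) λ { (ni-outa ()) ; (ni-outb ()) }

  no-capture-by-2 : ∀ x y → x ∈ (2 ∷ []) → PlainFree y (inp 0 (var 2 ∷ []) (guarded 2)) → σ₀ y ≢ x
  no-capture-by-2 x y (here refl) pf-inc = λ ()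
  no-capture-by-2 x y (here refl) (pf-ink pf y∉2) with plainFree-guarded pf
  ... | inj₁ refl = ⊥-elim (y∉2 (here refl))
  ... | inj₂ refl = λ ()

  σ₂↦₁-fixes-non-placeholders : ∀ y → ¬ (y ∈ (2 ∷ [])) → σ₂↦₁ y ≡ y
  σ₂↦₁-fixes-non-placeholders 0 _ = refl
  σ₂↦₁-fixes-non-placeholders 1 _ = refl
  σ₂↦₁-fixes-non-placeholders 2 y∉2 = ⊥-elim (y∉2 (here refl))
  σ₂↦₁-fixes-non-placeholders (suc (suc (suc _))) _ = refl

  handshake : instantiate-2-by-1 [ guarded 2 ] —[ τ ]→ ν 0 (𝟘 ∥ guarded 1)
  handshake =
    t-res ¬plainFree-ν
          (s-par (s-out s-nil)
                 (s-inp idName (λ _ _ _ _ e → e) no-capture-by-2 (sub-guarded _ 2 (λ ()) (λ ()))))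
          (t-coml t-out (t-inp σ₂↦₁ (m-var refl m-nil , σ₂↦₁-fixes-non-placeholders) (sub-guarded σ₂↦₁ 2 (λ ()) (λ ())))
                  (λ _ ()))
          (λ ())

proposition4p3 : Σ Ctx λ C → Σ Proc λ I → Σ Proc λ P →
                   Invisible I × (C [ I ]) ⇓ × ¬ ((C [ P ]) ⇓)
proposition4p3 =
  instantiate-2-by-1 , guarded 2 , 𝟘 ,
  stuck⇒invisible stuck-guarded-2 , instantiate-guarded-2-⇓ , invisible-instantiate-𝟘
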